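{- For every $f:[m]^2\to\{0,1\}$, $d(U_f,\mathbf{Sym})\ge\frac16 d(f,\mathbf{sym})$.
   Context: Let $C:[m]\to\{0,1\}^m$ be a systematic code: minimal normalized codeword distance at least $\frac13$ and $C(a)$ is determined by its first $\lceil\log_2 m\rceil$ bits. For $x\in\{0,1\}^{2m}$, its key $\kappa(x)$ is the element of $[m]$ decoded from the first $\lceil\log_2 m\rceil$ bits. $\mathbf{Sym}$ is the set of distributions $P$ over $\{0,1\}^{2m}$ such that $\Pr_{x\sim P}[\exists a\in[m]: x_1\dots x_m=C(a)]=1$ and for all $a,b\in[m]$, $\Pr_{x,y\sim P}[x_1\dots x_m=C(a)\wedge y_1\dots y_m=C(b)\wedge x_{m+b}\ne y_{m+a}]=0$ ($x,y$ independent). $\mathbf{sym}$ is the set of symmetric functions $g:[m]^2\to\{0,1\}$ ($g(i,j)=g(j,i)$ for all $i,j$), and $d(f,\mathbf{sym})$ is the minimum over $g\in\mathbf{sym}$ of the fraction of pairs $(i,j)\in[m]^2$ with $f(i,j)\ne g(i,j)$. $U_f$ is the uniform distribution over the $m$ strings $C(a)f(a,1)f(a,2)\dots f(a,m)\in\{0,1\}^{2m}$, $a\in[m]$. Distances between distributions are earth mover's distances with respect to normalized Hamming distance on $\{0,1\}^{2m}$, and $d(P,\mathbf{Sym})=\inf_{Q\in\mathbf{Sym}}d(P,Q)$.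
   Formalization: The distributions $Q$ in $\mathbf{Sym}$ and the transport plans between $U_f$ and $Q$ defining the earth mover's distance have rational weights only. -}

module Defs where

open import Data.Nat using (ℕ; zero; suc; NonZero; _≤_) renaming (_+_ to _+ℕ_; _*_ to _*ℕ_; _<_ to _<ℕ_)
open import Data.Nat.Properties using (m*n≢0)
open import Data.Nat.Logarithm using (⌈log₂_⌉)
open import Data.Bool using (Bool; true; false; if_then_else_)
open import Data.Fin using (Fin; zero; suc; toℕ; _↑ˡ_; _↑ʳ_; splitAt)
open import Data.Sum using ([_,_]′)
open import Data.Integer using (+_)
open import Data.Rational using (ℚ; 0ℚ; 1ℚ; _+_; _*_; _/_; _<_) renaming (_≤_ to _≤ℚ_)
open import Data.Product using (Σ; ∃; ∃-syntax; _×_)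
open import Relation.Binary.PropositionalEquality using (_≡_; _≢_)
open import Relation.Nullary using (¬_)

Bits : ℕ → Set
Bits n = Fin n → Bool

_≠ᵇ_ : Bool → Bool → Bool
false ≠ᵇ false = false
true  ≠ᵇ true  = false
_     ≠ᵇ _     = true

count : (n : ℕ) → (Fin n → Bool) → ℕ
count zero    p = 0
count (suc n) p = (if p zero then 1 else 0) +ℕ count n (λ i → p (suc i))

hamming : (n : ℕ) → Bits n → Bits n → ℕ
hamming n x y = count n (λ i → x i ≠ᵇ y i)

sumℕ : (n : ℕ) → (Fin n → ℕ) → ℕ
sumℕ zero    v = 0
sumℕ (suc n) v = v zero +ℕ sumℕ n (λ i → v (suc i))

sumℚ : (n : ℕ) → (Fin n → ℚ) → ℚ
sumℚ zero    v = 0ℚ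
sumℚ (suc n) v = v zero + sumℚ n (λ i → v (suc i))

ℕ→ℚ : ℕ → ℚ
ℕ→ℚ n = + n / 1

-- minimal normalised codeword distance ≥ 1/3, i.e. 3·Δ(C a, C b) ≥ m for a ≠ b
MinDistThird : (m : ℕ) → (Fin m → Bits m) → Set
MinDistThird m C = ∀ a b → a ≢ b → m ≤ 3 *ℕ hamming m (C a) (C b)

PrefixDetermined : (m : ℕ) → (Fin m → Bits m) → Set
PrefixDetermined m C =
  ∀ a b → (∀ i → toℕ i <ℕ ⌈log₂ m ⌉ → C a i ≡ C b i) → ∀ i → C a i ≡ C b i

IsSystematicCode : (m : ℕ) → (Fin m → Bits m) → Set
IsSystematicCode m C = MinDistThird m C × PrefixDetermined m C

HasPrefix : (m : ℕ) → Bits (m +ℕ m) → Bits m → Set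
HasPrefix m x c = ∀ i → x (i ↑ˡ m) ≡ c i

-- x_{m+b}  (b ∈ [m], 0-indexed)
second : (m : ℕ) → Bits (m +ℕ m) → Fin m → Bool
second m x b = x (m ↑ʳ b)

-- finitely supported distributions over {0,1}^{2m} with rational weights,
-- given as a weighted list of points (repetitions allowed)

record FinDist (m : ℕ) : Set where
  field
    size   : ℕ
    point  : Fin size → Bits (m +ℕ m)
    weight : Fin size → ℚ
    weight-nonneg : ∀ j → 0ℚ ≤ℚ weight j
    weight-sum    : sumℚ size weight ≡ 1ℚ
open FinDist public

-- membership in Sym (conditions on the support, i.e. points of positive weight;
-- the pair condition includes the case that x and y are the same sample point)
InSym : (m : ℕ) → (Fin m → Bits m) → FinDist m → Set
InSym m C Q =
  (∀ j → 0ℚ < weight Q j → ∃[ a ] HasPrefix m (point Q j) (C a))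
  × (∀ j k a b → 0ℚ < weight Q j → 0ℚ < weight Q k →
       HasPrefix m (point Q j) (C a) → HasPrefix m (point Q k) (C b) →
       second m (point Q j) b ≡ second m (point Q k) a)

-- U_f : uniform over the m strings C(a) f(a,1) … f(a,m)

Ufpoint : (m : ℕ) → (Fin m → Bits m) → (Fin m → Fin m → Bool) → Fin m → Bits (m +ℕ m)
Ufpoint m C f a idx = [ C a , f a ]′ (splitAt m idx)

Ufweight : (m : ℕ) → .{{NonZero m}} → ℚ
Ufweight m = + 1 / m

record Coupling (m : ℕ) .{{_ : NonZero m}} (C : Fin m → Bits m)
                (f : Fin m → Fin m → Bool) (Q : FinDist m) : Set where
  field
    plan        : Fin m → Fin (size Q) → ℚ
    plan-nonneg : ∀ a j → 0ℚ ≤ℚ plan a j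
    plan-left   : ∀ a → sumℚ (size Q) (plan a) ≡ Ufweight m
    plan-right  : ∀ j → sumℚ m (λ a → plan a j) ≡ weight Q j
open Coupling public

normHam : (m : ℕ) → .{{NonZero m}} → Bits (m +ℕ m) → Bits (m +ℕ m) → ℚ
normHam m x y = + hamming (m +ℕ m) x y / (2 *ℕ m)
  where instance _ : NonZero (2 *ℕ m)
                 _ = m*n≢0 2 m

cost : (m : ℕ) .{{_ : NonZero m}} (C : Fin m → Bits m) (f : Fin m → Fin m → Bool)
       (Q : FinDist m) → Coupling m C f Q → ℚ
cost m C f Q γ =
  sumℚ m (λ a → sumℚ (size Q) (λ j → plan γ a j * normHam m (Ufpoint m C f a) (point Q j)))

IsSymmetric : (m : ℕ) → (Fin m → Fin m → Bool) → Set
IsSymmetric m g = ∀ i j → g i j ≡ g j i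

mismatches : (m : ℕ) → (Fin m → Fin m → Bool) → (Fin m → Fin m → Bool) → ℕ
mismatches m f g = sumℕ m (λ i → count m (λ j → f i j ≠ᵇ g i j))

distFun : (m : ℕ) .{{_ : NonZero m}} → (Fin m → Fin m → Bool) → (Fin m → Fin m → Bool) → ℚ
distFun m f g = + mismatches m f g / (m *ℕ m)
  where instance _ : NonZero (m *ℕ m)
                 _ = m*n≢0 m m

{-# OPTIONS --safe #-}
-- Read a symmetric g off the support of Q. If the keys a and b both occur on the
-- support, g(a,b) is the bit x_{m+b} of any support point x with prefix C(a); the Sym
-- condition makes this independent of x and symmetric in a, b. If only one of a, b
-- occurs, g copies f on the side of that key. Now let y be a support point. If y has
-- prefix C(a), every mismatch between f and g in row a is a mismatch between f(a,·)
-- and the second half of y, so it is counted by Δ(U_a, y). Otherwise the prefix of y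
-- is another codeword, so Δ(U_a, y) ≥ m/3 while row a has at most m mismatches.
-- Either way the row-a mismatches are at most 3·Δ(U_a, y) = 6m·d(U_a, y), and
-- averaging over a coupling of U_f and Q gives d(f,g)/6 ≤ cost.
module Submission where

open import Defs
open import Data.Nat using (ℕ; NonZero)
open import Data.Fin using (Fin)
open import Data.Bool using (Bool)
open import Data.Integer using (+_)
open import Data.Rational using (_/_; _*_; _≤_)
open import Data.Product using (∃-syntax; _×_)

import Data.Nat as ℕ
import Data.Nat.Properties as ℕ
open import Data.Nat.Tactic.RingSolver using (solve)
import Data.Integer as ℤ
import Data.Integer.Properties as ℤ
open import Data.Rational using (ℚ; 0ℚ; _+_; _<_; toℚᵘ; nonNegative)
open import Data.Rational.Properties
  using ( toℚᵘ-injective; toℚᵘ-fromℚᵘ; toℚᵘ-homo-+; toℚᵘ-homo-*; toℚᵘ-cancel-≤; /-cong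
        ; ≤-refl; ≤-antisym; ≤-reflexive; ≮⇒≥; _<?_; +-mono-≤; +-identityˡ; +-identityʳ
        ; *-zeroˡ; *-zeroʳ; *-distribˡ-+; *-distribʳ-+; *-monoˡ-≤-nonNeg; module ≤-Reasoning )
open import Data.Rational.Unnormalised as ℚᵘ using (mkℚᵘ; *≡*; *≤*) renaming (_/_ to _/ᵘ_; _≃_ to _≃ᵘ_)
import Data.Rational.Unnormalised.Properties as ℚᵘ
open import Data.Fin using (zero; suc; _↑ˡ_; _↑ʳ_; _≟_)
open import Data.Fin.Properties using (any?; all?; splitAt-↑ˡ; splitAt-↑ʳ)
open import Data.Bool using (true; false; if_then_else_)
import Data.Bool.Properties as Bool
open import Data.List using (_∷_; [])
open import Data.Product using (_,_; proj₁; proj₂)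
open import Data.Sum using (_⊎_; inj₁; inj₂)
open import Data.Empty using (⊥-elim)
open import Function using (_∘_)
open import Relation.Nullary using (Dec; yes; no; ¬_)
open import Relation.Nullary.Decidable using (_×-dec_)
open import Relation.Unary using (Decidable)
open import Relation.Binary.PropositionalEquality

toℚᵘ-/ : ∀ i d .{{_ : NonZero d}} → toℚᵘ (i / d) ≃ᵘ i /ᵘ d
toℚᵘ-/ i (ℕ.suc d) = toℚᵘ-fromℚᵘ (mkℚᵘ i d)

/-*-/ : ∀ i j a b .{{_ : NonZero a}} .{{_ : NonZero b}} .{{_ : NonZero (a ℕ.* b)}} →
        (i / a) * (j / b) ≡ (i ℤ.* j) / (a ℕ.* b)
/-*-/ i j a@(ℕ.suc _) b@(ℕ.suc _) = toℚᵘ-injective (begin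
  toℚᵘ (i / a * (j / b))          ≈⟨ toℚᵘ-homo-* (i / a) (j / b) ⟩
  toℚᵘ (i / a) ℚᵘ.* toℚᵘ (j / b) ≈⟨ ℚᵘ.*-cong (toℚᵘ-/ i a) (toℚᵘ-/ j b) ⟩
  (i ℤ.* j) /ᵘ (a ℕ.* b)          ≈⟨ toℚᵘ-/ (i ℤ.* j) (a ℕ.* b) ⟨
  toℚᵘ ((i ℤ.* j) / (a ℕ.* b))    ∎)
  where open ℚᵘ.≃-Reasoning

/-*-/-exchange : ∀ i j a b c d .{{_ : NonZero a}} .{{_ : NonZero b}} .{{_ : NonZero c}} .{{_ : NonZero d}} →
                 a ℕ.* b ≡ c ℕ.* d → (i / a) * (j / b) ≡ (i / c) * (j / d)
/-*-/-exchange i j a b c d ab≡cd = begin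
  (i / a) * (j / b)      ≡⟨ /-*-/ i j a b ⟩
  (i ℤ.* j) / (a ℕ.* b)  ≡⟨ /-cong {i ℤ.* j} refl ab≡cd ⟩
  (i ℤ.* j) / (c ℕ.* d)  ≡⟨ /-*-/ i j c d ⟨
  (i / c) * (j / d)      ∎
  where
  open ≡-Reasoning
  instance
    ab≢0 : NonZero (a ℕ.* b)
    ab≢0 = ℕ.m*n≢0 a b
    cd≢0 : NonZero (c ℕ.* d)
    cd≢0 = ℕ.m*n≢0 c d

/-+-/ : ∀ i j d .{{_ : NonZero d}} → (i / d) + (j / d) ≡ (i ℤ.+ j) / d
/-+-/ i j d@(ℕ.suc _) = toℚᵘ-injective (begin
  toℚᵘ (i / d + j / d)            ≈⟨ toℚᵘ-homo-+ (i / d) (j / d) ⟩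
  toℚᵘ (i / d) ℚᵘ.+ toℚᵘ (j / d) ≈⟨ ℚᵘ.+-cong (toℚᵘ-/ i d) (toℚᵘ-/ j d) ⟩
  i /ᵘ d ℚᵘ.+ j /ᵘ d             ≈⟨ *≡* common-denominator ⟩
  (i ℤ.+ j) /ᵘ d                  ≈⟨ toℚᵘ-/ (i ℤ.+ j) d ⟨
  toℚᵘ ((i ℤ.+ j) / d)            ∎)
  where
  open ℚᵘ.≃-Reasoning
  common-denominator : (i ℤ.* + d ℤ.+ j ℤ.* + d) ℤ.* + d ≡ (i ℤ.+ j) ℤ.* (+ d ℤ.* + d)
  common-denominator = trans (cong (ℤ._* + d) (sym (ℤ.*-distribʳ-+ (+ d) i j)))
                             (ℤ.*-assoc (i ℤ.+ j) (+ d) (+ d))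

0/n≡0 : ∀ d .{{_ : NonZero d}} → + 0 / d ≡ 0ℚ
0/n≡0 d@(ℕ.suc _) = toℚᵘ-injective (ℚᵘ.≃-trans (toℚᵘ-/ (+ 0) d) (*≡* refl))

i*e≤j*d⇒i/d≤j/e : ∀ i j d e .{{_ : NonZero d}} .{{_ : NonZero e}} →
                   i ℕ.* e ℕ.≤ j ℕ.* d → + i / d ≤ + j / e
i*e≤j*d⇒i/d≤j/e i j d@(ℕ.suc _) e@(ℕ.suc _) ie≤jd = toℚᵘ-cancel-≤
  (ℚᵘ.≤-respˡ-≃ (ℚᵘ.≃-sym (toℚᵘ-/ (+ i) d)) (ℚᵘ.≤-respʳ-≃ (ℚᵘ.≃-sym (toℚᵘ-/ (+ j) e))
    (*≤* (subst₂ ℤ._≤_ (ℤ.pos-* i e) (ℤ.pos-* j d) (ℤ.+≤+ ie≤jd)))))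

i≤k*j⇒i/[k*d]≤j/d : ∀ k i j d .{{_ : NonZero d}} .{{_ : NonZero (k ℕ.* d)}} →
                     i ℕ.≤ k ℕ.* j → + i / (k ℕ.* d) ≤ + j / d
i≤k*j⇒i/[k*d]≤j/d k i j d i≤kj = i*e≤j*d⇒i/d≤j/e i j (k ℕ.* d) d (begin
  i ℕ.* d          ≤⟨ ℕ.*-monoˡ-≤ d i≤kj ⟩
  k ℕ.* j ℕ.* d    ≡⟨ cong (ℕ._* d) (ℕ.*-comm k j) ⟩
  j ℕ.* k ℕ.* d    ≡⟨ ℕ.*-assoc j k d ⟩
  j ℕ.* (k ℕ.* d)  ∎)
  where open ℕ.≤-Reasoning

sumℚ-/ : ∀ n (v : Fin n → ℕ) d .{{_ : NonZero d}} → sumℚ n (λ k → + v k / d) ≡ + sumℕ n v / d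
sumℚ-/ ℕ.zero    v d = sym (0/n≡0 d)
sumℚ-/ (ℕ.suc n) v d = trans (cong (_+_ (+ v zero / d)) (sumℚ-/ n (v ∘ suc) d))
                             (/-+-/ (+ v zero) (+ sumℕ n (v ∘ suc)) d)

sumℚ-cong : ∀ n {v w : Fin n → ℚ} → (∀ i → v i ≡ w i) → sumℚ n v ≡ sumℚ n w
sumℚ-cong ℕ.zero    v≗w = refl
sumℚ-cong (ℕ.suc n) v≗w = cong₂ _+_ (v≗w zero) (sumℚ-cong n (v≗w ∘ suc))

sumℚ-mono-≤ : ∀ n {v w : Fin n → ℚ} → (∀ i → v i ≤ w i) → sumℚ n v ≤ sumℚ n w
sumℚ-mono-≤ ℕ.zero    v≤w = ≤-refl
sumℚ-mono-≤ (ℕ.suc n) v≤w = +-mono-≤ (v≤w zero) (sumℚ-mono-≤ n (v≤w ∘ suc))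

*-distribˡ-sumℚ : ∀ n c (v : Fin n → ℚ) → c * sumℚ n v ≡ sumℚ n (λ i → c * v i)
*-distribˡ-sumℚ ℕ.zero    c v = *-zeroʳ c
*-distribˡ-sumℚ (ℕ.suc n) c v =
  trans (*-distribˡ-+ c (v zero) _) (cong (_+_ (c * v zero)) (*-distribˡ-sumℚ n c (v ∘ suc)))

*-distribʳ-sumℚ : ∀ n c (v : Fin n → ℚ) → sumℚ n v * c ≡ sumℚ n (λ i → v i * c)
*-distribʳ-sumℚ ℕ.zero    c v = *-zeroˡ c
*-distribʳ-sumℚ (ℕ.suc n) c v =
  trans (*-distribʳ-+ c (v zero) _) (cong (_+_ (v zero * c)) (*-distribʳ-sumℚ n c (v ∘ suc)))

sumℚ-nonNeg : ∀ n {v : Fin n → ℚ} → (∀ i → 0ℚ ≤ v i) → 0ℚ ≤ sumℚ n v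
sumℚ-nonNeg ℕ.zero    v≥0 = ≤-refl
sumℚ-nonNeg (ℕ.suc n) v≥0 = +-mono-≤ (v≥0 zero) (sumℚ-nonNeg n (v≥0 ∘ suc))

≤-sumℚ : ∀ n {v : Fin n → ℚ} → (∀ i → 0ℚ ≤ v i) → ∀ i → v i ≤ sumℚ n v
≤-sumℚ (ℕ.suc n) {v} v≥0 zero = begin
  v zero       ≡⟨ +-identityʳ (v zero) ⟨
  v zero + 0ℚ  ≤⟨ +-mono-≤ (≤-refl {v zero}) (sumℚ-nonNeg n (v≥0 ∘ suc)) ⟩
  sumℚ (ℕ.suc n) v ∎
  where open ≤-Reasoning
≤-sumℚ (ℕ.suc n) {v} v≥0 (suc i) = begin
  v (suc i)       ≡⟨ +-identityˡ (v (suc i)) ⟨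
  0ℚ + v (suc i)  ≤⟨ +-mono-≤ (v≥0 zero) (≤-sumℚ n (v≥0 ∘ suc) i) ⟩
  sumℚ (ℕ.suc n) v ∎
  where open ≤-Reasoning

count-≤ : ∀ n p → count n p ℕ.≤ n
count-≤ ℕ.zero    p = ℕ.z≤n
count-≤ (ℕ.suc n) p with p zero
... | true  = ℕ.s≤s (count-≤ n (p ∘ suc))
... | false = ℕ.m≤n⇒m≤1+n (count-≤ n (p ∘ suc))

count-mono : ∀ n {p q : Fin n → Bool} → (∀ i → p i ≡ true → q i ≡ true) → count n p ℕ.≤ count n q
count-mono ℕ.zero          p⇒q = ℕ.z≤n
count-mono (ℕ.suc n) {p} {q} p⇒q with p zero | q zero | p⇒q zero
... | true  | true  | _  = ℕ.s≤s (count-mono n (p⇒q ∘ suc))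
... | true  | false | p₀⇒q₀ with () ← p₀⇒q₀ refl
... | false | true  | _  = ℕ.m≤n⇒m≤1+n (count-mono n (p⇒q ∘ suc))
... | false | false | _  = count-mono n (p⇒q ∘ suc)

count-+ : ∀ n k p → count (n ℕ.+ k) p ≡ count n (p ∘ (_↑ˡ k)) ℕ.+ count k (p ∘ (n ↑ʳ_))
count-+ ℕ.zero    k p = refl
count-+ (ℕ.suc n) k p = trans (cong ((if p zero then 1 else 0) ℕ.+_) (count-+ n k (p ∘ suc)))
                              (sym (ℕ.+-assoc (if p zero then 1 else 0) _ _))

hamming-↑ˡ-≤ : ∀ n k (x y : Bits (n ℕ.+ k)) →
               hamming n (x ∘ (_↑ˡ k)) (y ∘ (_↑ˡ k)) ℕ.≤ hamming (n ℕ.+ k) x y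
hamming-↑ˡ-≤ n k x y = ℕ.≤-trans (ℕ.m≤m+n _ _) (ℕ.≤-reflexive (sym (count-+ n k (λ i → x i ≠ᵇ y i))))

hamming-↑ʳ-≤ : ∀ n k (x y : Bits (n ℕ.+ k)) →
               hamming k (x ∘ (n ↑ʳ_)) (y ∘ (n ↑ʳ_)) ℕ.≤ hamming (n ℕ.+ k) x y
hamming-↑ʳ-≤ n k x y = ℕ.≤-trans (ℕ.m≤n+m _ _) (ℕ.≤-reflexive (sym (count-+ n k (λ i → x i ≠ᵇ y i))))

≠ᵇ-transfer : ∀ {x y z} → z ≡ y ⊎ z ≡ x → (x ≠ᵇ z) ≡ true → (x ≠ᵇ y) ≡ true
≠ᵇ-transfer         (inj₁ refl) x≠y = x≠y
≠ᵇ-transfer {false} (inj₂ refl) ()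
≠ᵇ-transfer {true}  (inj₂ refl) ()

module _ {m : ℕ} .{{_ : NonZero m}} {C : Fin m → Bits m} {f : Fin m → Fin m → Bool} {Q : FinDist m}
         (γ : Coupling m C f Q) where

  plan-outside-support : ∀ a j → ¬ (0ℚ < weight Q j) → plan γ a j ≡ 0ℚ
  plan-outside-support a j w≯0 = ≤-antisym (begin
    plan γ a j                       ≤⟨ ≤-sumℚ m (λ a′ → plan-nonneg γ a′ j) a ⟩
    sumℚ m (λ a′ → plan γ a′ j)      ≡⟨ plan-right γ j ⟩
    weight Q j                       ≤⟨ ≮⇒≥ w≯0 ⟩
    0ℚ                               ∎) (plan-nonneg γ a j)
    where open ≤-Reasoning

  mean≤cost : (c : Fin m → ℚ) →
              (∀ a j → 0ℚ < weight Q j → c a ≤ normHam m (Ufpoint m C f a) (point Q j)) →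
              Ufweight m * sumℚ m c ≤ cost m C f Q γ
  mean≤cost c c≤distance = begin
    Ufweight m * sumℚ m c                                  ≡⟨ *-distribˡ-sumℚ m (Ufweight m) c ⟩
    sumℚ m (λ a → Ufweight m * c a)                        ≡⟨ sumℚ-cong m (λ a → cong (_* c a) (plan-left γ a)) ⟨
    sumℚ m (λ a → sumℚ (size Q) (plan γ a) * c a)          ≡⟨ sumℚ-cong m (λ a → *-distribʳ-sumℚ (size Q) (c a) (plan γ a)) ⟩
    sumℚ m (λ a → sumℚ (size Q) (λ j → plan γ a j * c a)) ≤⟨ sumℚ-mono-≤ m (λ a → sumℚ-mono-≤ (size Q) (termwise a)) ⟩
    cost m C f Q γ                                         ∎
    where
    open ≤-Reasoning
    distance : Fin m → Fin (size Q) → ℚ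
    distance a j = normHam m (Ufpoint m C f a) (point Q j)
    termwise : ∀ a j → plan γ a j * c a ≤ plan γ a j * distance a j
    termwise a j with 0ℚ <? weight Q j
    ... | yes w>0 = *-monoˡ-≤-nonNeg (plan γ a j) {{nonNegative (plan-nonneg γ a j)}} (c≤distance a j w>0)
    ... | no  w≯0 rewrite plan-outside-support a j w≯0 =
      ≤-reflexive (trans (*-zeroˡ (c a)) (sym (*-zeroˡ (distance a j))))

Ufpoint-↑ˡ : ∀ m C f a i → Ufpoint m C f a (i ↑ˡ m) ≡ C a i
Ufpoint-↑ˡ m C f a i rewrite splitAt-↑ˡ m i m = refl

Ufpoint-↑ʳ : ∀ m C f a b → second m (Ufpoint m C f a) b ≡ f a b
Ufpoint-↑ʳ m C f a b rewrite splitAt-↑ʳ m m b = refl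

otherKey⇒m≤3*hamming : ∀ {m C} → MinDistThird m C → ∀ f {a a′} {y : Bits (m ℕ.+ m)} → a ≢ a′ →
                       HasPrefix m y (C a′) → m ℕ.≤ 3 ℕ.* hamming (m ℕ.+ m) (Ufpoint m C f a) y
otherKey⇒m≤3*hamming {m} {C} minDist f {a} {a′} {y} a≢a′ y↦a′ = begin
  m                                            ≤⟨ minDist a a′ a≢a′ ⟩
  3 ℕ.* hamming m (C a) (C a′)                 ≤⟨ ℕ.*-monoʳ-≤ 3 (count-mono m codewords-differ⇒prefixes-differ) ⟩
  3 ℕ.* hamming m (x ∘ (_↑ˡ m)) (y ∘ (_↑ˡ m))  ≤⟨ ℕ.*-monoʳ-≤ 3 (hamming-↑ˡ-≤ m m x y) ⟩
  3 ℕ.* hamming (m ℕ.+ m) x y                  ∎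
  where
  open ℕ.≤-Reasoning
  x : Bits (m ℕ.+ m)
  x = Ufpoint m C f a
  codewords-differ⇒prefixes-differ : ∀ i → (C a i ≠ᵇ C a′ i) ≡ true → (x (i ↑ˡ m) ≠ᵇ y (i ↑ˡ m)) ≡ true
  codewords-differ⇒prefixes-differ i =
    subst₂ (λ u v → (u ≠ᵇ v) ≡ true) (sym (Ufpoint-↑ˡ m C f a i)) (sym (y↦a′ i))

module Symmetrization {m : ℕ} (C : Fin m → Bits m) (Q : FinDist m) (Q∈Sym : InSym m C Q)
                      (f : Fin m → Fin m → Bool) where

  KeyInSupport : Fin m → Set
  KeyInSupport a = ∃[ j ] (0ℚ < weight Q j × HasPrefix m (point Q j) (C a))

  keyInSupport? : Decidable KeyInSupport
  keyInSupport? a = any? λ j → (0ℚ <? weight Q j) ×-dec all? (λ i → point Q j (i ↑ˡ m) Bool.≟ C a i)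

  entry : ∀ a b → Dec (KeyInSupport a) → Dec (KeyInSupport b) → Bool
  entry a b (yes (j , _)) (yes _) = second m (point Q j) b
  entry a b (yes _)       (no _)  = f a b
  entry a b (no _)        (yes _) = f b a
  entry a b (no _)        (no _)  = false

  g : Fin m → Fin m → Bool
  g a b = entry a b (keyInSupport? a) (keyInSupport? b)

  g-symmetric : IsSymmetric m g
  g-symmetric a b = entry-symmetric (keyInSupport? a) (keyInSupport? b)
    where
    entry-symmetric : ∀ sa sb → entry a b sa sb ≡ entry b a sb sa
    entry-symmetric (yes (j , wj , j↦a)) (yes (k , wk , k↦b)) = proj₂ Q∈Sym j k a b wj wk j↦a k↦b
    entry-symmetric (yes _) (no _)  = refl
    entry-symmetric (no _)  (yes _) = refl
    entry-symmetric (no _)  (no _)  = refl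

  g-row : ∀ {a j} → 0ℚ < weight Q j → HasPrefix m (point Q j) (C a) →
          ∀ b → g a b ≡ second m (point Q j) b ⊎ g a b ≡ f a b
  g-row {a} {j} wj j↦a b = entry-row (keyInSupport? a) (keyInSupport? b)
    where
    entry-row : ∀ sa sb → entry a b sa sb ≡ second m (point Q j) b ⊎ entry a b sa sb ≡ f a b
    entry-row (no ¬sa) _ = ⊥-elim (¬sa (j , wj , j↦a))
    entry-row (yes (j′ , wj′ , j′↦a)) (yes (k , wk , k↦b)) =
      inj₁ (trans (proj₂ Q∈Sym j′ k a b wj′ wk j′↦a k↦b) (sym (proj₂ Q∈Sym j k a b wj wk j↦a k↦b)))
    entry-row (yes _) (no _) = inj₂ refl

  rowMismatches : Fin m → ℕ
  rowMismatches a = count m (λ b → f a b ≠ᵇ g a b)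

  rowMismatches≤hamming : ∀ {a j} → 0ℚ < weight Q j → HasPrefix m (point Q j) (C a) →
                          rowMismatches a ℕ.≤ hamming (m ℕ.+ m) (Ufpoint m C f a) (point Q j)
  rowMismatches≤hamming {a} {j} wj j↦a =
    ℕ.≤-trans (count-mono m mismatch⇒suffixes-differ) (hamming-↑ʳ-≤ m m (Ufpoint m C f a) (point Q j))
    where
    mismatch⇒suffixes-differ : ∀ b → (f a b ≠ᵇ g a b) ≡ true →
                               (Ufpoint m C f a (m ↑ʳ b) ≠ᵇ point Q j (m ↑ʳ b)) ≡ true
    mismatch⇒suffixes-differ b =
      subst (λ u → (u ≠ᵇ point Q j (m ↑ʳ b)) ≡ true) (sym (Ufpoint-↑ʳ m C f a b)) ∘ ≠ᵇ-transfer (g-row wj j↦a b)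

  rowMismatches≤3*hamming : MinDistThird m C → ∀ a j → 0ℚ < weight Q j →
                            rowMismatches a ℕ.≤ 3 ℕ.* hamming (m ℕ.+ m) (Ufpoint m C f a) (point Q j)
  rowMismatches≤3*hamming minDist a j wj with proj₁ Q∈Sym j wj
  ... | a′ , j↦a′ with a ≟ a′
  ... | yes refl = ℕ.≤-trans (rowMismatches≤hamming wj j↦a′) (ℕ.m≤n*m _ 3)
  ... | no a≢a′  = ℕ.≤-trans (count-≤ m _) (otherKey⇒m≤3*hamming minDist f a≢a′ j↦a′)

mainTheorem17 : (m : ℕ) .{{_ : NonZero m}} (C : Fin m → Bits m) → IsSystematicCode m C →
    (f : Fin m → Fin m → Bool) (Q : FinDist m) → InSym m C Q → (γ : Coupling m C f Q) →
    ∃[ g ] (IsSymmetric m g × (+ 1 / 6) * distFun m f g ≤ cost m C f Q γ)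
mainTheorem17 m C (minDist , _) f Q Q∈Sym γ = g , g-symmetric , (begin
  + 1 / 6 * distFun m f g                             ≡⟨ /-*-/-exchange (+ 1) (+ M) 6 (m ℕ.* m) m 6m same-denominator ⟩
  Ufweight m * (+ M / 6m)                             ≡⟨ cong (Ufweight m *_) (sumℚ-/ m rowMismatches 6m) ⟨
  Ufweight m * sumℚ m (λ a → + rowMismatches a / 6m)  ≤⟨ mean≤cost γ _ row≤normHam ⟩
  cost m C f Q γ                                      ∎)
  where
  open Symmetrization C Q Q∈Sym f
  open ≤-Reasoning
  M : ℕ
  M = mismatches m f g
  6m : ℕ
  6m = 3 ℕ.* (2 ℕ.* m)
  same-denominator : 6 ℕ.* (m ℕ.* m) ≡ m ℕ.* (3 ℕ.* (2 ℕ.* m))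
  same-denominator = solve (m ∷ [])
  instance
    m²≢0 : NonZero (m ℕ.* m)
    m²≢0 = ℕ.m*n≢0 m m
    2m≢0 : NonZero (2 ℕ.* m)
    2m≢0 = ℕ.m*n≢0 2 m
    6m≢0 : NonZero 6m
    6m≢0 = ℕ.m*n≢0 3 (2 ℕ.* m)
  row≤normHam : ∀ a j → 0ℚ < weight Q j → + rowMismatches a / 6m ≤ normHam m (Ufpoint m C f a) (point Q j)
  row≤normHam a j wj =
    i≤k*j⇒i/[k*d]≤j/d 3 (rowMismatches a) (hamming (m ℕ.+ m) (Ufpoint m C f a) (point Q j)) (2 ℕ.* m)
                      (rowMismatches≤3*hamming minDist a j wj)
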